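{- Let $a$ be a non-zero integer. Let $\triangle=\{x^2+xy+y^2:\ x,y\in\mathbb{Z}\}$, $\square_2=\{u^2+v^2:\ u,v\in\mathbb{Z}\}$, and $S(\triangle,\square_2,a)=\{n\in\mathbb{Z}:\ n\in\triangle,\ n+a\in\square_2\}$. Define \[ \Upsilon(a)=\begin{cases}1/2 & \text{if } a\in\{n^2-3m^2:\ n,m\in\mathbb{Z}\},\\ 5/8 & \text{otherwise.}\end{cases} \] Then there exists a constant $D_a>0$ such that for every real $x\geq 1$ the interval $[x,\,x+D_a x^{\Upsilon(a)}]$ contains an element of $S(\triangle,\square_2,a)$.
   Formalization: The parameter x ranges only over rationals $x\geq 1$ rather than all real $x\geq 1$, and the constant $D_a$ is taken in ℚ. -}

module Defs where

open import Data.Nat using (ℕ; zero; suc)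
open import Data.Integer using (ℤ; +_) renaming (_+_ to _+ℤ_; _*_ to _*ℤ_; _-_ to _-ℤ_)
open import Data.Rational using (ℚ; _/_; _*_; _-_; _≤_; 1ℚ)
open import Data.Product using (Σ; _×_; ∃-syntax)
open import Relation.Binary.PropositionalEquality using (_≡_)
open import Relation.Nullary using (¬_)

_^ℚ_ : ℚ → ℕ → ℚ
q ^ℚ zero = 1ℚ
q ^ℚ suc k = q * (q ^ℚ k)

ι : ℤ → ℚ
ι z = z / 1

InTriangle : ℤ → Set
InTriangle n = ∃[ x ] ∃[ y ] (n ≡ x *ℤ x +ℤ x *ℤ y +ℤ y *ℤ y)

InSquare2 : ℤ → Set
InSquare2 n = ∃[ u ] ∃[ v ] (n ≡ u *ℤ u +ℤ v *ℤ v)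

InS : ℤ → ℤ → Set
InS a n = InTriangle n × InSquare2 (n +ℤ a)

IsNorm3 : ℤ → Set
IsNorm3 a = ∃[ n ] ∃[ m ] (a ≡ n *ℤ n -ℤ (+ 3) *ℤ (m *ℤ m))

-- For x ≤ n (so n − x ≥ 0), D > 0, x ≥ 1:
--   n ≤ x + D·x^{1/2}  ⇔  (n − x)² ≤ D²·x
--   n ≤ x + D·x^{5/8}  ⇔  (n − x)⁸ ≤ D⁸·x⁵
-- UpsilonBound a D x n encodes  n ≤ x + D·x^{Υ(a)}  with Υ(a) by cases.
UpsilonBound : ℤ → ℚ → ℚ → ℤ → Set
UpsilonBound a D x n =
  (IsNorm3 a → ((ι n - x) ^ℚ 2) ≤ (D ^ℚ 2) * x) ×
  (¬ IsNorm3 a → ((ι n - x) ^ℚ 8) ≤ (D ^ℚ 8) * (x ^ℚ 5))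

-- Every n = x² + xy + y² lies in △; write a = P − A with P, A natural.
-- If a = w² − 3m², take y = 2m: then n = (x + m)² + 3m², so n + a = (x + m)² + w², and x = ⌊√N⌋ + 1
-- gives an element of S(△, □₂, a) in (N, N + O(√N)].
-- For arbitrary a take x = s, y = 2b + 1: then n + a = (s + b)² + u² as soon as u² = s + 1 + a + 3b² + 4b.
-- With s₀ = ⌊√N⌋ + 1, let u² be the first square above s₀ + 1 + P; its excess is O(N^{1/4}) and is
-- written 3b² + 4b + d with b, d = O(N^{1/8}), so s = s₀ + A + d works and n − N = O(s₀ N^{1/8}) = O(N^{5/8}).
-- Which case applies is decidable: multiplying w + m√3 by the unit 2 − √3 lowers m while m > |a|,
-- so a = w² − 3m² can be checked by a bounded search.
module Submission where

open import Defs

module Arithmetic where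

  open import Data.Nat
  open import Data.Nat.Properties
  open import Data.Nat.Solver using (module +-*-Solver)
  open +-*-Solver using (solve; _:+_; _:*_; _:^_; _:=_; con)
  open import Data.Product using (_×_; _,_; ∃-syntax)
  open import Relation.Binary.PropositionalEquality
  open import Relation.Nullary using (yes; no)
  open import Algebra.Properties.CommutativeSemigroup *-commutativeSemigroup using (interchange)

  ^-distrib-* : ∀ m n k → (m * n) ^ k ≡ m ^ k * n ^ k
  ^-distrib-* m n zero = refl
  ^-distrib-* m n (suc k) = trans (cong (m * n *_) (^-distrib-* m n k)) (interchange m n (m ^ k) (n ^ k))

  ^-cancelˡ-< : ∀ k {m n} → m ^ k < n ^ k → m < n
  ^-cancelˡ-< k mᵏ<nᵏ = ≰⇒> (λ n≤m → <⇒≱ mᵏ<nᵏ (^-monoˡ-≤ k n≤m))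

  ^-cancelˡ-≤ : ∀ k .{{_ : NonZero k}} {m n} → m ^ k ≤ n ^ k → m ≤ n
  ^-cancelˡ-≤ k mᵏ≤nᵏ = ≮⇒≥ (λ n<m → <⇒≱ (^-monoˡ-< k n<m) mᵏ≤nᵏ)

  x²≤C*t²ⁱ⇒x≤C*tⁱ : ∀ {x C t} i .{{_ : NonZero C}} → x ^ 2 ≤ C * t ^ (2 * i) → x ≤ C * t ^ i
  x²≤C*t²ⁱ⇒x≤C*tⁱ {x} {C} {t} i x²≤Ct²ⁱ = ^-cancelˡ-≤ 2 (begin
    x ^ 2               ≤⟨ x²≤Ct²ⁱ ⟩
    C * t ^ (2 * i)     ≤⟨ *-monoˡ-≤ (t ^ (2 * i)) (m≤m*n C (C * 1) {{m*n≢0 C 1}}) ⟩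
    C ^ 2 * t ^ (2 * i) ≡⟨ cong (C ^ 2 *_) (trans (^-*-assoc t i 2) (cong (t ^_) (*-comm i 2))) ⟨
    C ^ 2 * (t ^ i) ^ 2 ≡⟨ ^-distrib-* C (t ^ i) 2 ⟨
    (C * t ^ i) ^ 2     ∎)
    where open ≤-Reasoning

  ≤-rescale : ∀ {M C t B N} j k → M ≤ C * t ^ j → t ^ k ≤ B * N → M ^ k ≤ (C ^ k * B ^ j) * N ^ j
  ≤-rescale {M} {C} {t} {B} {N} j k M≤Ctʲ tᵏ≤BN = begin
    M ^ k                   ≤⟨ ^-monoˡ-≤ k M≤Ctʲ ⟩
    (C * t ^ j) ^ k         ≡⟨ ^-distrib-* C (t ^ j) k ⟩
    C ^ k * (t ^ j) ^ k     ≡⟨ cong (C ^ k *_) (^-comm t j k) ⟩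
    C ^ k * (t ^ k) ^ j     ≤⟨ *-monoʳ-≤ (C ^ k) (^-monoˡ-≤ j tᵏ≤BN) ⟩
    C ^ k * (B * N) ^ j     ≡⟨ cong (C ^ k *_) (^-distrib-* B N j) ⟩
    C ^ k * (B ^ j * N ^ j) ≡⟨ *-assoc (C ^ k) (B ^ j) (N ^ j) ⟨
    (C ^ k * B ^ j) * N ^ j ∎
    where
    open ≤-Reasoning
    ^-comm : ∀ t j k → (t ^ j) ^ k ≡ (t ^ k) ^ j
    ^-comm t j k = trans (^-*-assoc t j k) (trans (cong (t ^_) (*-comm j k)) (sym (^-*-assoc t k j)))

  bracket : (f : ℕ → ℕ) → (∀ r → f r < f (suc r)) →
            ∀ {N} → f 0 ≤ N → ∃[ r ] (f r ≤ N × N < f (suc r))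
  bracket f f↑ {zero} f0≤0 = 0 , f0≤0 , ≤-<-trans z≤n (f↑ 0)
  bracket f f↑ {suc N} f0≤1+N with f 0 ≤? N
  ... | no f0≰N = 0 , f0≤1+N , ≤-<-trans (≰⇒> f0≰N) (f↑ 0)
  ... | yes f0≤N with bracket f f↑ f0≤N
  ...   | r , fr≤N , N<fr+1 with suc N <? f (suc r)
  ...     | yes 1+N<fr+1 = r , m≤n⇒m≤1+n fr≤N , 1+N<fr+1
  ...     | no 1+N≮fr+1 = suc r , ≮⇒≥ 1+N≮fr+1 , ≤-<-trans N<fr+1 (f↑ (suc r))

  floor-root : ∀ k .{{_ : NonZero k}} N → ∃[ r ] (r ^ k ≤ N × N < suc r ^ k)
  floor-root (suc k) N = bracket (_^ suc k) (λ r → ^-monoˡ-< (suc k) (n<1+n r)) z≤n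

  [1+r]^k≤2^k*[1+N] : ∀ k r {N} → r ^ k ≤ N → suc r ^ k ≤ 2 ^ k * suc N
  [1+r]^k≤2^k*[1+N] k zero {N} _ = begin
    1 ^ k          ≡⟨ ^-zeroˡ k ⟩
    1              ≤⟨ m≤n*m 1 (2 ^ k) {{m^n≢0 2 k}} ⟩
    2 ^ k * 1      ≤⟨ *-monoʳ-≤ (2 ^ k) (s≤s z≤n) ⟩
    2 ^ k * suc N  ∎
    where open ≤-Reasoning
  [1+r]^k≤2^k*[1+N] k (suc r) {N} rᵏ≤N = begin
    suc (suc r) ^ k   ≤⟨ ^-monoˡ-≤ k (m≤m+n (2 + r) r) ⟩
    (2 + r + r) ^ k   ≡⟨ cong (_^ k) (2+r+r≡2*[1+r] r) ⟩
    (2 * suc r) ^ k   ≡⟨ ^-distrib-* 2 (suc r) k ⟩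
    2 ^ k * suc r ^ k ≤⟨ *-monoʳ-≤ (2 ^ k) (m≤n⇒m≤1+n rᵏ≤N) ⟩
    2 ^ k * suc N     ∎
    where
    open ≤-Reasoning
    2+r+r≡2*[1+r] : ∀ r → 2 + r + r ≡ 2 * suc r
    2+r+r≡2*[1+r] = solve 1 (λ r → con 2 :+ r :+ r := con 2 :* (con 1 :+ r)) refl

  next-square : ∀ V → ∃[ u ] ∃[ R ] (V + R ≡ suc u ^ 2 × u ^ 2 ≤ V × R ≤ 2 * u + 1)
  next-square V with floor-root 2 V
  ... | u , u²≤V , V<[1+u]² = u , suc u ^ 2 ∸ V , m+[n∸m]≡n (<⇒≤ V<[1+u]²) , u²≤V , R≤2u+1
    where
    R≤2u+1 : suc u ^ 2 ∸ V ≤ 2 * u + 1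
    R≤2u+1 = begin
      suc u ^ 2 ∸ V               ≤⟨ ∸-monoʳ-≤ (suc u ^ 2) u²≤V ⟩
      suc u ^ 2 ∸ u ^ 2           ≡⟨ cong (_∸ u ^ 2) (expand u) ⟩
      u ^ 2 + (2 * u + 1) ∸ u ^ 2 ≡⟨ m+n∸m≡n (u ^ 2) (2 * u + 1) ⟩
      2 * u + 1                   ∎
      where
      open ≤-Reasoning
      expand : ∀ u → suc u ^ 2 ≡ u ^ 2 + (2 * u + 1)
      expand = solve 1 (λ u → (con 1 :+ u) :^ 2 := u :^ 2 :+ (con 2 :* u :+ con 1)) refl

  square-excess : ∀ {N n} r y → r ^ 2 ≤ N → n ≤ (r + y) ^ 2 → n ≤ N + y * (2 * r + y)
  square-excess {N} {n} r y r²≤N n≤[r+y]² = begin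
    n                       ≤⟨ n≤[r+y]² ⟩
    (r + y) ^ 2             ≡⟨ expand r y ⟩
    r ^ 2 + y * (2 * r + y) ≤⟨ +-monoˡ-≤ (y * (2 * r + y)) r²≤N ⟩
    N + y * (2 * r + y)     ∎
    where
    open ≤-Reasoning
    expand : ∀ r y → (r + y) ^ 2 ≡ r ^ 2 + y * (2 * r + y)
    expand = solve 2 (λ r y → (r :+ y) :^ 2 := r :^ 2 :+ y :* (con 2 :* r :+ y)) refl

  excess-bound : ∀ {r y Y t} i e .{{_ : NonZero t}} → y ≤ Y * t ^ i → suc r ≤ t ^ e → i ≤ e →
                 y * (2 * r + y) ≤ (Y * (2 + Y)) * t ^ (i + e)
  excess-bound {r} {y} {Y} {t} i e y≤Ytⁱ 1+r≤tᵉ i≤e = begin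
    y * (2 * r + y)                       ≤⟨ *-mono-≤ y≤Ytⁱ (+-mono-≤ (*-monoʳ-≤ 2 r≤tᵉ) y≤Ytᵉ) ⟩
    (Y * t ^ i) * (2 * t ^ e + Y * t ^ e) ≡⟨ cong (Y * t ^ i *_) (*-distribʳ-+ (t ^ e) 2 Y) ⟨
    (Y * t ^ i) * ((2 + Y) * t ^ e)       ≡⟨ interchange Y (t ^ i) (2 + Y) (t ^ e) ⟩
    (Y * (2 + Y)) * (t ^ i * t ^ e)       ≡⟨ cong (Y * (2 + Y) *_) (^-distribˡ-+-* t i e) ⟨
    (Y * (2 + Y)) * t ^ (i + e)           ∎
    where
    open ≤-Reasoning
    r≤tᵉ = ≤-trans (n≤1+n r) 1+r≤tᵉ
    y≤Ytᵉ = ≤-trans y≤Ytⁱ (*-monoʳ-≤ Y (^-monoʳ-≤ t i≤e))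

  square-approximation : ∀ {N n r y Y t B} i e k .{{_ : NonZero t}} →
    r ^ 2 ≤ N → n ≤ (r + y) ^ 2 → y ≤ Y * t ^ i → suc r ≤ t ^ e → i ≤ e → t ^ k ≤ B * suc N →
    ∃[ M ] (n ≤ N + M × M ^ k ≤ ((Y * (2 + Y)) ^ k * B ^ (i + e)) * suc N ^ (i + e))
  square-approximation {r = r} {y} {Y} {t} i e k r²≤N n≤[r+y]² y≤Ytⁱ 1+r≤tᵉ i≤e tᵏ≤B[1+N] =
    y * (2 * r + y) , square-excess r y r²≤N n≤[r+y]² ,
    ≤-rescale (i + e) k (excess-bound {r} {y} {Y} {t} i e y≤Ytⁱ 1+r≤tᵉ i≤e) tᵏ≤B[1+N]

module Integers where

  open import Data.Nat as ℕ using (suc; _^_)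
  import Data.Nat.Properties as ℕ
  open import Data.Integer as ℤ using (+_; -[1+_]; _+_; _*_)
  import Data.Integer.Properties as ℤ
  open import Algebra.Bundles using (AbelianGroup)
  open import Algebra.Properties.Group (AbelianGroup.group ℤ.+-0-abelianGroup) using (∙-cancelʳ)
  open import Data.Product using (_,_; ∃-syntax)
  open import Relation.Binary.PropositionalEquality

  as-difference : ∀ a → ∃[ A ] ∃[ P ] (+ P ≡ a + + A)
  as-difference (+ k) = 0 , k , sym (ℤ.+-identityʳ (+ k))
  as-difference -[1+ k ] = suc k , 0 , sym (ℤ.n⊖n≡0 (suc k))

  shift⇒ : ∀ {A P Y} a X → P ≡ a + A → X + a ≡ Y → X + P ≡ Y + A
  shift⇒ {A} a X refl refl = sym (ℤ.+-assoc X a A)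

  shift⇐ : ∀ {A P Y} a X → P ≡ a + A → X + P ≡ Y + A → X + a ≡ Y
  shift⇐ {A} a X refl X+P≡Y+A = ∙-cancelʳ A (X + a) _ (trans (ℤ.+-assoc X a A) X+P≡Y+A)

  pos-^2 : ∀ n → + (n ^ 2) ≡ + n * + n
  pos-^2 n = trans (ℤ.pos-* n (n ℕ.* 1)) (cong (λ k → + n * + k) (ℕ.*-identityʳ n))

  pos-triangle : ∀ x y → + (x ^ 2 ℕ.+ x ℕ.* y ℕ.+ y ^ 2) ≡ + x * + x + + x * + y + + y * + y
  pos-triangle x y = begin
    + (x ^ 2 ℕ.+ x ℕ.* y ℕ.+ y ^ 2)     ≡⟨ ℤ.pos-+ (x ^ 2 ℕ.+ x ℕ.* y) (y ^ 2) ⟩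
    + (x ^ 2 ℕ.+ x ℕ.* y) + + (y ^ 2)   ≡⟨ cong₂ _+_ (ℤ.pos-+ (x ^ 2) (x ℕ.* y)) (pos-^2 y) ⟩
    + (x ^ 2) + + (x ℕ.* y) + + y * + y ≡⟨ cong₂ (λ p q → p + q + + y * + y) (pos-^2 x) (ℤ.pos-* x y) ⟩
    + x * + x + + x * + y + + y * + y   ∎
    where open ≡-Reasoning

  pos-sum-of-squares : ∀ u v → + (u ^ 2 ℕ.+ v ^ 2) ≡ + u * + u + + v * + v
  pos-sum-of-squares u v = trans (ℤ.pos-+ (u ^ 2) (v ^ 2)) (cong₂ _+_ (pos-^2 u) (pos-^2 v))

  InS-from-ℕ : ∀ {a A P} x y u v → + P ≡ a + + A →
               x ^ 2 ℕ.+ x ℕ.* y ℕ.+ y ^ 2 ℕ.+ P ≡ u ^ 2 ℕ.+ v ^ 2 ℕ.+ A →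
               InS a (+ (x ^ 2 ℕ.+ x ℕ.* y ℕ.+ y ^ 2))
  InS-from-ℕ {a} {A} {P} x y u v P≡a+A n+P≡u²+v²+A =
    (+ x , + y , pos-triangle x y) , (+ u , + v , shift⇐ a (+ n) P≡a+A n+P≡u²+v²+A′)
    where
    open ≡-Reasoning
    n = x ^ 2 ℕ.+ x ℕ.* y ℕ.+ y ^ 2
    n+P≡u²+v²+A′ : + n + + P ≡ + u * + u + + v * + v + + A
    n+P≡u²+v²+A′ = begin
      + n + + P                   ≡⟨ ℤ.pos-+ n P ⟨
      + (n ℕ.+ P)                 ≡⟨ cong +_ n+P≡u²+v²+A ⟩
      + (u ^ 2 ℕ.+ v ^ 2 ℕ.+ A)   ≡⟨ ℤ.pos-+ (u ^ 2 ℕ.+ v ^ 2) A ⟩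
      + (u ^ 2 ℕ.+ v ^ 2) + + A   ≡⟨ cong (_+ + A) (pos-sum-of-squares u v) ⟩
      + u * + u + + v * + v + + A ∎

module NormsOf3 where

  open Integers
  open import Data.Nat as ℕ using (ℕ; suc; _<_; _≤_; _∸_; _^_; z≤n; s≤s)
  import Data.Nat.Properties as ℕ
  open import Data.Nat.Induction using (<-rec)
  open import Data.Integer as ℤ using (ℤ; +_; -[1+_]; ∣_∣; _+_; _*_; _-_)
  import Data.Integer.Properties as ℤ
  open import Data.Integer.Tactic.RingSolver using (solve-∀)
  open import Data.Product using (_×_; _,_; ∃-syntax)
  open import Relation.Binary.PropositionalEquality
  open import Relation.Nullary using (Dec; yes; no)
  open import Relation.Nullary.Decidable using (map′)
  open Arithmetic using (^-cancelˡ-<; ^-distrib-*)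

  Norm3 : ℤ → ℕ → ℕ → Set
  Norm3 a w m = a ≡ + w * + w - + 3 * (+ m * + m)

  +∣i∣*+∣i∣≡i*i : ∀ i → + ∣ i ∣ * + ∣ i ∣ ≡ i * i
  +∣i∣*+∣i∣≡i*i (+ n) = refl
  +∣i∣*+∣i∣≡i*i -[1+ n ] = refl

  IsNorm3⇒Norm3 : ∀ {a} → IsNorm3 a → ∃[ w ] ∃[ m ] Norm3 a w m
  IsNorm3⇒Norm3 (w , m , a≡w²-3m²) =
    ∣ w ∣ , ∣ m ∣ ,
    trans a≡w²-3m² (sym (cong₂ (λ p q → p - + 3 * q) (+∣i∣*+∣i∣≡i*i w) (+∣i∣*+∣i∣≡i*i m)))

  Norm3⇒ℕ : ∀ {a A P} w m → + P ≡ a + + A → Norm3 a w m → 3 ℕ.* m ^ 2 ℕ.+ P ≡ w ^ 2 ℕ.+ A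
  Norm3⇒ℕ {a} {A} {P} w m P≡a+A a≡w²-3m² = ℤ.+-injective (begin
    + (3 ℕ.* m ^ 2 ℕ.+ P)   ≡⟨ ℤ.pos-+ (3 ℕ.* m ^ 2) P ⟩
    + (3 ℕ.* m ^ 2) + + P   ≡⟨ cong (_+ + P) (trans (ℤ.pos-* 3 (m ^ 2)) (cong (+ 3 *_) (pos-^2 m))) ⟩
    + 3 * (+ m * + m) + + P ≡⟨ shift⇒ a (+ 3 * (+ m * + m)) P≡a+A 3m²+a≡w² ⟩
    + w * + w + + A         ≡⟨ cong (_+ + A) (pos-^2 w) ⟨
    + (w ^ 2) + + A         ≡⟨ ℤ.pos-+ (w ^ 2) A ⟨
    + (w ^ 2 ℕ.+ A)         ∎)
    where
    open ≡-Reasoning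
    cancel : ∀ x y → x + (y - x) ≡ y
    cancel = solve-∀
    3m²+a≡w² : + 3 * (+ m * + m) + a ≡ + w * + w
    3m²+a≡w² = trans (cong (_+_ (+ 3 * (+ m * + m))) a≡w²-3m²) (cancel (+ 3 * (+ m * + m)) (+ w * + w))

  -- (2w − 3m) + (2m − w)√3 = (w + m√3)(2 − √3), and 2 − √3 has norm 1.
  unit-step : ∀ w m → w * w - + 3 * (m * m)
                    ≡ (+ 2 * w - + 3 * m) * (+ 2 * w - + 3 * m) - + 3 * ((+ 2 * m - w) * (+ 2 * m - w))
  unit-step = solve-∀

  pos-∸ : ∀ {m n} → n ≤ m → + (m ∸ n) ≡ + m - + n
  pos-∸ {m} {n} n≤m = sym (trans (ℤ.m-n≡m⊖n m n) (ℤ.⊖-≥ n≤m))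

  norm3-descent : ∀ {a A P} w m → + P ≡ a + + A → A ℕ.+ P < m → Norm3 a w m →
                  ∃[ w′ ] ∃[ m′ ] (m′ < m × Norm3 a w′ m′)
  norm3-descent {a} {A} {P} w m@(suc _) P≡a+A A+P<m a≡w²-3m² =
    ∣ W′ ∣ , 2 ℕ.* m ∸ w , m′<m , a≡w′²-3m′²
    where
    open ℕ.≤-Reasoning
    3m²+P≡w²+A : 3 ℕ.* m ^ 2 ℕ.+ P ≡ w ^ 2 ℕ.+ A
    3m²+P≡w²+A = Norm3⇒ℕ w m P≡a+A a≡w²-3m²
    m≤m² : m ≤ m ^ 2
    m≤m² = ℕ.m≤m*n m (m ℕ.* 1)
    A<m² : A < m ^ 2
    A<m² = ℕ.<-≤-trans (ℕ.≤-<-trans (ℕ.m≤m+n A P) A+P<m) m≤m²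
    P<m² : P < m ^ 2
    P<m² = ℕ.<-≤-trans (ℕ.≤-<-trans (ℕ.m≤n+m P A) A+P<m) m≤m²
    m<w : m < w
    m<w = ℕ.≰⇒> λ w≤m → ℕ.<-irrefl refl (begin-strict
      3 ℕ.* m ^ 2       ≤⟨ ℕ.m≤m+n (3 ℕ.* m ^ 2) P ⟩
      3 ℕ.* m ^ 2 ℕ.+ P ≡⟨ 3m²+P≡w²+A ⟩
      w ^ 2 ℕ.+ A       ≤⟨ ℕ.+-monoˡ-≤ A (ℕ.^-monoˡ-≤ 2 w≤m) ⟩
      m ^ 2 ℕ.+ A       <⟨ ℕ.+-monoʳ-< (m ^ 2) A<m² ⟩
      m ^ 2 ℕ.+ m ^ 2   ≤⟨ ℕ.+-monoʳ-≤ (m ^ 2) (ℕ.m≤m+n (m ^ 2) (m ^ 2 ℕ.+ 0)) ⟩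
      3 ℕ.* m ^ 2       ∎)
    w<2m : w < 2 ℕ.* m
    w<2m = ^-cancelˡ-< 2 (begin-strict
      w ^ 2                 ≤⟨ ℕ.m≤m+n (w ^ 2) A ⟩
      w ^ 2 ℕ.+ A           ≡⟨ 3m²+P≡w²+A ⟨
      3 ℕ.* m ^ 2 ℕ.+ P     <⟨ ℕ.+-monoʳ-< (3 ℕ.* m ^ 2) P<m² ⟩
      3 ℕ.* m ^ 2 ℕ.+ m ^ 2 ≡⟨ ℕ.+-comm (3 ℕ.* m ^ 2) (m ^ 2) ⟩
      4 ℕ.* m ^ 2           ≡⟨ ^-distrib-* 2 m 2 ⟨
      (2 ℕ.* m) ^ 2         ∎)
    2m<w+m : 2 ℕ.* m < w ℕ.+ m
    2m<w+m = ℕ.≤-<-trans (ℕ.≤-reflexive (cong (m ℕ.+_) (ℕ.+-identityʳ m))) (ℕ.+-monoˡ-< m m<w)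
    m′<m : 2 ℕ.* m ∸ w < m
    m′<m = ℕ.m<n+o⇒m∸n<o (2 ℕ.* m) w 2m<w+m
    W′ = + 2 * + w - + 3 * + m
    M′≡ : + (2 ℕ.* m ∸ w) ≡ + 2 * + m - + w
    M′≡ = trans (pos-∸ (ℕ.<⇒≤ w<2m)) (cong (_- + w) (ℤ.pos-* 2 m))
    a≡w′²-3m′² : Norm3 a ∣ W′ ∣ (2 ℕ.* m ∸ w)
    a≡w′²-3m′² = trans a≡w²-3m² (trans (unit-step (+ w) (+ m))
      (sym (cong₂ (λ p q → p - + 3 * q) (+∣i∣*+∣i∣≡i*i W′) (cong₂ _*_ M′≡ M′≡))))

  module _ {a A P} (P≡a+A : + P ≡ a + + A) where

    Reduced : Set
    Reduced = ∃[ w ] ∃[ m ] (m ≤ A ℕ.+ P × Norm3 a w m)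

    norm3-reduce : ∀ m w → Norm3 a w m → Reduced
    norm3-reduce = <-rec _ reduce
      where
      reduce : ∀ m → (∀ {m′} → m′ < m → ∀ w → Norm3 a w m′ → Reduced) → ∀ w → Norm3 a w m → Reduced
      reduce m rec w norm with m ℕ.≤? A ℕ.+ P
      ... | yes m≤A+P = w , m , m≤A+P , norm
      ... | no m≰A+P with norm3-descent w m P≡a+A (ℕ.≰⇒> m≰A+P) norm
      ...   | w′ , m′ , m′<m , norm′ = rec m′<m w′ norm′

    norm3-bound : ∀ w m → m ≤ A ℕ.+ P → Norm3 a w m → w ≤ 3 ℕ.* (A ℕ.+ P) ^ 2 ℕ.+ P
    norm3-bound w m m≤A+P norm = begin
      w                         ≤⟨ n≤n² w ⟩
      w ^ 2                     ≤⟨ ℕ.m≤m+n (w ^ 2) A ⟩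
      w ^ 2 ℕ.+ A               ≡⟨ Norm3⇒ℕ w m P≡a+A norm ⟨
      3 ℕ.* m ^ 2 ℕ.+ P         ≤⟨ ℕ.+-monoˡ-≤ P (ℕ.*-monoʳ-≤ 3 (ℕ.^-monoˡ-≤ 2 m≤A+P)) ⟩
      3 ℕ.* (A ℕ.+ P) ^ 2 ℕ.+ P ∎
      where
      open ℕ.≤-Reasoning
      n≤n² : ∀ n → n ≤ n ^ 2
      n≤n² ℕ.zero = z≤n
      n≤n² n@(suc _) = ℕ.m≤m*n n (n ℕ.* 1)

  isNorm3? : ∀ a → Dec (IsNorm3 a)
  isNorm3? a with as-difference a
  ... | A , P , P≡a+A = map′ found complete (ℕ.anyUpTo? (λ m → ℕ.anyUpTo? (norm3? m) (suc B)) (suc (A ℕ.+ P)))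
    where
    norm3? : ∀ m w → Dec (Norm3 a w m)
    norm3? m w = a ℤ.≟ + w * + w - + 3 * (+ m * + m)
    B = 3 ℕ.* (A ℕ.+ P) ^ 2 ℕ.+ P
    Search = ∃[ m ] (m < suc (A ℕ.+ P) × ∃[ w ] (w < suc B × Norm3 a w m))
    found : Search → IsNorm3 a
    found (m , _ , w , _ , norm) = + w , + m , norm
    complete : IsNorm3 a → Search
    complete isNorm3 with IsNorm3⇒Norm3 isNorm3
    ... | w , m , norm with norm3-reduce P≡a+A m w norm
    ...   | w′ , m′ , m′≤A+P , norm′ =
      m′ , s≤s m′≤A+P , w′ , s≤s (norm3-bound P≡a+A w′ m′ m′≤A+P norm′) , norm′

module Approximants where

  open Arithmetic
  open Integers
  open NormsOf3 using (IsNorm3⇒Norm3; Norm3⇒ℕ)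
  open import Data.Nat
  open import Data.Nat.Properties
  open import Data.Nat.Solver using (module +-*-Solver)
  open +-*-Solver using (solve; _:+_; _:*_; _:^_; _:=_; con)
  open import Data.Integer using (ℤ; +_)
  open import Data.Product using (_×_; _,_; ∃-syntax)
  open import Relation.Binary.PropositionalEquality

  -- The gap M is O(N ^ (j / k)); the two cases of the theorem are j / k = Υ(a).
  Approximant : ℤ → ℕ → ℕ → ℕ → ℕ → Set
  Approximant a k j K N = ∃[ n ] ∃[ M ] (InS a (+ n) × N < n × n ≤ N + M × M ^ k ≤ K * suc N ^ j)

  Dense : ℤ → ℕ → ℕ → ℕ → Set
  Dense a k j K = ∀ N → Approximant a k j K N

  completed-square-identity : ∀ x m w A P → 3 * m ^ 2 + P ≡ w ^ 2 + A →
                              x ^ 2 + x * (2 * m) + (2 * m) ^ 2 + P ≡ (x + m) ^ 2 + w ^ 2 + A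
  completed-square-identity x m w A P 3m²+P≡w²+A = begin
    x ^ 2 + x * (2 * m) + (2 * m) ^ 2 + P ≡⟨ expand x m P ⟩
    (x + m) ^ 2 + (3 * m ^ 2 + P)         ≡⟨ cong (_+_ ((x + m) ^ 2)) 3m²+P≡w²+A ⟩
    (x + m) ^ 2 + (w ^ 2 + A)             ≡⟨ +-assoc ((x + m) ^ 2) (w ^ 2) A ⟨
    (x + m) ^ 2 + w ^ 2 + A               ∎
    where
    open ≡-Reasoning
    expand : ∀ x m P → x ^ 2 + x * (2 * m) + (2 * m) ^ 2 + P ≡ (x + m) ^ 2 + (3 * m ^ 2 + P)
    expand = solve 3 (λ x m P → x :^ 2 :+ x :* (con 2 :* m) :+ (con 2 :* m) :^ 2 :+ P
                              := (x :+ m) :^ 2 :+ (con 3 :* m :^ 2 :+ P)) refl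

  completed-square-bounds : ∀ {N} r y → N < suc r ^ 2 →
    let n = suc r ^ 2 + suc r * y + y ^ 2 in N < n × n ≤ (r + suc y) ^ 2
  completed-square-bounds {N} r y N<[1+r]² = N<n , n≤[r+1+y]²
    where
    n = suc r ^ 2 + suc r * y + y ^ 2
    N<n : N < n
    N<n = <-≤-trans N<[1+r]² (≤-trans (m≤m+n (suc r ^ 2) (suc r * y)) (m≤m+n (suc r ^ 2 + suc r * y) (y ^ 2)))
    n≤[r+1+y]² : n ≤ (r + suc y) ^ 2
    n≤[r+1+y]² = ≤-trans (m≤m+n n (suc r * y)) (≤-reflexive (sym (expand r y)))
      where
      expand : ∀ r y → (r + suc y) ^ 2 ≡ suc r ^ 2 + suc r * y + y ^ 2 + suc r * y
      expand = solve 2 (λ r y → (r :+ (con 1 :+ y)) :^ 2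
                              := (con 1 :+ r) :^ 2 :+ (con 1 :+ r) :* y :+ y :^ 2 :+ (con 1 :+ r) :* y) refl

  dense-1/2 : ∀ {a} → IsNorm3 a → ∃[ K ] Dense a 2 1 K
  dense-1/2 {a} isNorm3 =
    let A , P , P≡a+A = as-difference a
        w , m , norm = IsNorm3⇒Norm3 isNorm3
        Y = suc (2 * m)
    in (Y * (2 + Y)) ^ 2 * (2 ^ 2) ^ (0 + 1) , λ N →
    let r , r²≤N , N<[1+r]² = floor-root 2 N
        N<n , n≤[r+Y]² = completed-square-bounds r (2 * m) N<[1+r]²
        M , n≤N+M , bound = square-approximation {Y = Y} {suc r} {2 ^ 2} 0 1 2 r²≤N n≤[r+Y]²
                              (≤-reflexive (sym (*-identityʳ Y))) (≤-reflexive (sym (*-identityʳ (suc r)))) z≤n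
                              ([1+r]^k≤2^k*[1+N] 2 r r²≤N)
        n+P≡ = completed-square-identity (suc r) m w A P (Norm3⇒ℕ w m P≡a+A norm)
    in _ , M , InS-from-ℕ {a} (suc r) (2 * m) (suc r + m) w P≡a+A n+P≡ , N<n , n≤N+M , bound

  -- n = s² + s(2b + 1) + (2b + 1)² exceeds (s + b)² by s + 1 + g b, so n + a = (s + b)² + u²
  -- exactly when u² = s + 1 + a + g b.
  g : ℕ → ℕ
  g b = 3 * b ^ 2 + 4 * b

  g-suc : ∀ b → g (suc b) ≡ g b + suc (6 * b + 6)
  g-suc = solve 1 (λ b → con 3 :* (con 1 :+ b) :^ 2 :+ con 4 :* (con 1 :+ b)
                       := con 3 :* b :^ 2 :+ con 4 :* b :+ (con 1 :+ (con 6 :* b :+ con 6))) refl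

  g-split : ∀ R → ∃[ b ] ∃[ d ] (g b + d ≡ R × d ≤ 6 * b + 6)
  g-split R with bracket g (λ b → ≤-trans (m<m+n (g b) z<s) (≤-reflexive (sym (g-suc b)))) z≤n
  ... | b , gb≤R , R<g[1+b] =
    b , R ∸ g b , m+[n∸m]≡n gb≤R ,
    m<1+n⇒m≤n (m<n+o⇒m∸n<o R (g b) (<-≤-trans R<g[1+b] (≤-reflexive (g-suc b))))

  b²≤g[b] : ∀ b → b ^ 2 ≤ g b
  b²≤g[b] b = ≤-trans (m≤m+n (b ^ 2) (2 * b ^ 2)) (m≤m+n (3 * b ^ 2) (4 * b))

  shifted-identity : ∀ A P r b d U → suc r + suc P + (g b + d) ≡ U →
    let s = suc r + (A + d) ; c = 2 * b + 1 in s ^ 2 + s * c + c ^ 2 + P ≡ (s + b) ^ 2 + U + A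
  shifted-identity A P r b d U V+gb+d≡U = begin
    s ^ 2 + s * c + c ^ 2 + P                     ≡⟨ expand A P r b d ⟩
    (s + b) ^ 2 + (suc r + suc P + (g b + d)) + A ≡⟨ cong (λ X → (s + b) ^ 2 + X + A) V+gb+d≡U ⟩
    (s + b) ^ 2 + U + A                           ∎
    where
    open ≡-Reasoning
    s = suc r + (A + d)
    c = 2 * b + 1
    expand : ∀ A P r b d → (suc r + (A + d)) ^ 2 + (suc r + (A + d)) * (2 * b + 1) + (2 * b + 1) ^ 2 + P
                         ≡ (suc r + (A + d) + b) ^ 2 + (suc r + suc P + (g b + d)) + A
    expand = solve 5 (λ A P r b d →
      (con 1 :+ r :+ (A :+ d)) :^ 2 :+ (con 1 :+ r :+ (A :+ d)) :* (con 2 :* b :+ con 1) :+ (con 2 :* b :+ con 1) :^ 2 :+ P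
      := (con 1 :+ r :+ (A :+ d) :+ b) :^ 2 :+ (con 1 :+ r :+ (con 1 :+ P) :+ (con 3 :* b :^ 2 :+ con 4 :* b :+ d)) :+ A) refl

  shifted-bounds : ∀ {N} r A d b → N < suc r ^ 2 →
    let s = suc r + (A + d) ; c = 2 * b + 1 ; n = s ^ 2 + s * c + c ^ 2 in N < n × n ≤ (r + (A + d + 2 * b + 2)) ^ 2
  shifted-bounds {N} r A d b N<[1+r]² = N<n , n≤[r+y]²
    where
    s = suc r + (A + d)
    c = 2 * b + 1
    n = s ^ 2 + s * c + c ^ 2
    N<n : N < n
    N<n = <-≤-trans N<[1+r]² (≤-trans (^-monoˡ-≤ 2 (m≤m+n (suc r) (A + d)))
            (≤-trans (m≤m+n (s ^ 2) (s * c)) (m≤m+n (s ^ 2 + s * c) (c ^ 2))))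
    n≤[r+y]² : n ≤ (r + (A + d + 2 * b + 2)) ^ 2
    n≤[r+y]² = ≤-trans (m≤m+n n (s * c)) (≤-reflexive (sym (expand r A d b)))
      where
      expand : ∀ r A d b → (r + (A + d + 2 * b + 2)) ^ 2
                         ≡ (suc r + (A + d)) ^ 2 + (suc r + (A + d)) * (2 * b + 1) + (2 * b + 1) ^ 2
                           + (suc r + (A + d)) * (2 * b + 1)
      expand = solve 4 (λ r A d b → (r :+ (A :+ d :+ con 2 :* b :+ con 2)) :^ 2
        := (con 1 :+ r :+ (A :+ d)) :^ 2 :+ (con 1 :+ r :+ (A :+ d)) :* (con 2 :* b :+ con 1) :+ (con 2 :* b :+ con 1) :^ 2
           :+ (con 1 :+ r :+ (A :+ d)) :* (con 2 :* b :+ con 1)) refl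

  shift-bound : ∀ A P {t r u R b d} .{{_ : NonZero t}} → suc r ≤ t ^ 4 → u ^ 2 ≤ suc r + suc P →
                R ≤ 2 * u + 1 → g b ≤ R → d ≤ 6 * b + 6 → A + d + 2 * b + 2 ≤ (A + 8 + 8 * (3 * (2 + P))) * t ^ 1
  shift-bound A P {t} {r} {u} {R} {b} {d} 1+r≤t⁴ u²≤V R≤2u+1 gb≤R d≤6b+6 = begin
    A + d + 2 * b + 2                           ≤⟨ +-monoˡ-≤ 2 (+-monoˡ-≤ (2 * b) (+-monoʳ-≤ A d≤6b+6)) ⟩
    A + (6 * b + 6) + 2 * b + 2                 ≡⟨ regroup A b ⟩
    A + 8 + 8 * b                               ≤⟨ +-mono-≤ (+-mono-≤ A≤At 8≤8t) (*-monoʳ-≤ 8 b≤3κt) ⟩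
    A * t ^ 1 + 8 * t ^ 1 + 8 * (3 * κ * t ^ 1) ≡⟨ factor A (3 * κ) (t ^ 1) ⟩
    (A + 8 + 8 * (3 * κ)) * t ^ 1               ∎
    where
    open ≤-Reasoning
    κ = 2 + P
    A≤At = m≤m*n A (t ^ 1) {{m^n≢0 t 1}}
    8≤8t = m≤m*n 8 (t ^ 1) {{m^n≢0 t 1}}
    u≤κt² : u ≤ κ * t ^ 2
    u≤κt² = x²≤C*t²ⁱ⇒x≤C*tⁱ {C = κ} {t} 2
              (≤-trans u²≤V (+-mono-≤ 1+r≤t⁴ (m≤m*n (suc P) (t ^ 4) {{m^n≢0 t 4}})))
    b≤3κt : b ≤ 3 * κ * t ^ 1
    b≤3κt = x²≤C*t²ⁱ⇒x≤C*tⁱ {C = 3 * κ} {t} 1 (begin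
      b ^ 2                       ≤⟨ b²≤g[b] b ⟩
      g b                         ≤⟨ gb≤R ⟩
      R                           ≤⟨ R≤2u+1 ⟩
      2 * u + 1                   ≤⟨ +-mono-≤ (*-monoʳ-≤ 2 u≤κt²) 1≤κt² ⟩
      2 * (κ * t ^ 2) + κ * t ^ 2 ≡⟨ +-comm (2 * (κ * t ^ 2)) (κ * t ^ 2) ⟩
      3 * (κ * t ^ 2)             ≡⟨ *-assoc 3 κ (t ^ 2) ⟨
      3 * κ * t ^ 2               ∎)
      where
      1≤κt² = >-nonZero⁻¹ (κ * t ^ 2) {{m*n≢0 κ (t ^ 2) {{_}} {{m^n≢0 t 2}}}}
    regroup : ∀ A b → A + (6 * b + 6) + 2 * b + 2 ≡ A + 8 + 8 * b
    regroup = solve 2 (λ A b → A :+ (con 6 :* b :+ con 6) :+ con 2 :* b :+ con 2 := A :+ con 8 :+ con 8 :* b) refl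
    factor : ∀ A c x → A * x + 8 * x + 8 * (c * x) ≡ (A + 8 + 8 * c) * x
    factor = solve 3 (λ A c x → A :* x :+ con 8 :* x :+ con 8 :* (c :* x) := (A :+ con 8 :+ con 8 :* c) :* x) refl

  dense-5/8 : ∀ a → ∃[ K ] Dense a 8 5 K
  dense-5/8 a =
    let A , P , P≡a+A = as-difference a
        Y = A + 8 + 8 * (3 * (2 + P))
    in (Y * (2 + Y)) ^ 8 * (2 ^ 8) ^ (1 + 4) , λ N →
    let q , q⁸≤N , N<[1+q]⁸ = floor-root 8 N
        r , r²≤N , N<[1+r]² = floor-root 2 N
        u , R , V+R≡[1+u]² , u²≤V , R≤2u+1 = next-square (suc r + suc P)
        b , d , gb+d≡R , d≤6b+6 = g-split R
        s = suc r + (A + d)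
        1+r≤t⁴ : suc r ≤ suc q ^ 4
        1+r≤t⁴ = ^-cancelˡ-< 2 (≤-<-trans r²≤N (<-≤-trans N<[1+q]⁸ (≤-reflexive (sym (^-*-assoc (suc q) 4 2)))))
        y≤Yt = shift-bound A P {suc q} {r} {u} {R} {b} {d} 1+r≤t⁴ u²≤V R≤2u+1
                 (≤-trans (m≤m+n (g b) d) (≤-reflexive gb+d≡R)) d≤6b+6
        N<n , n≤[r+y]² = shifted-bounds r A d b N<[1+r]²
        M , n≤N+M , bound = square-approximation {Y = Y} {suc q} {2 ^ 8} 1 4 8
                              r²≤N n≤[r+y]² y≤Yt 1+r≤t⁴ (s≤s z≤n) ([1+r]^k≤2^k*[1+N] 8 q q⁸≤N)
        n+P≡ = shifted-identity A P r b d (suc u ^ 2) (trans (cong (_+_ (suc r + suc P)) gb+d≡R) V+R≡[1+u]²)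
    in _ , M , InS-from-ℕ {a} s (2 * b + 1) (s + b) (suc u) P≡a+A n+P≡ , N<n , n≤N+M , bound

module Rationals where

  open Arithmetic using (bracket)
  open Approximants using (Approximant; Dense)
  open import Data.Nat as ℕ using (ℕ; suc; z≤n; s≤s)
  import Data.Nat.Properties as ℕ
  open import Data.Integer as ℤ using (+_; -[1+_]; +≤+)
  import Data.Integer.Properties as ℤ
  import Data.Nat.Coprimality as Coprime
  open import Data.Rational
  open import Data.Rational.Properties
  open import Algebra.Bundles using (CommutativeRing)
  open import Algebra.Properties.CommutativeSemigroup (CommutativeRing.*-commutativeSemigroup +-*-commutativeRing)
    using (interchange)
  open import Algebra.Properties.AbelianGroup +-0-abelianGroup using (xyx⁻¹≈y)
  open import Data.Product using (_×_; _,_; ∃-syntax)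
  open import Relation.Binary.PropositionalEquality

  ιℕ : ℕ → ℚ
  ιℕ n = ι (+ n)

  ιℕ-mkℚ : ∀ n → ιℕ n ≡ mkℚ (+ n) 0 (Coprime.sym (Coprime.1-coprimeTo n))
  ιℕ-mkℚ n = normalize-coprime (Coprime.sym (Coprime.1-coprimeTo n))

  ιℕ-+ : ∀ m n → ιℕ (m ℕ.+ n) ≡ ιℕ m + ιℕ n
  ιℕ-+ m n = trans (cong (_/ 1) pos-sum) (sym (cong₂ _+_ (ιℕ-mkℚ m) (ιℕ-mkℚ n)))
    where
    pos-sum : + (m ℕ.+ n) ≡ + m ℤ.* + 1 ℤ.+ + n ℤ.* + 1
    pos-sum = trans (ℤ.pos-+ m n) (sym (cong₂ ℤ._+_ (ℤ.*-identityʳ (+ m)) (ℤ.*-identityʳ (+ n))))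

  ιℕ-* : ∀ m n → ιℕ (m ℕ.* n) ≡ ιℕ m * ιℕ n
  ιℕ-* m n = trans (cong (_/ 1) (ℤ.pos-* m n)) (sym (cong₂ _*_ (ιℕ-mkℚ m) (ιℕ-mkℚ n)))

  ιℕ-^ : ∀ m k → ιℕ (m ℕ.^ k) ≡ ιℕ m ^ℚ k
  ιℕ-^ m ℕ.zero = refl
  ιℕ-^ m (suc k) = trans (ιℕ-* m (m ℕ.^ k)) (cong (ιℕ m *_) (ιℕ-^ m k))

  ιℕ-*^ : ∀ K m j → ιℕ (K ℕ.* m ℕ.^ j) ≡ ιℕ K * ιℕ m ^ℚ j
  ιℕ-*^ K m j = trans (ιℕ-* K (m ℕ.^ j)) (cong (ιℕ K *_) (ιℕ-^ m j))

  ιℕ-mono-≤ : ∀ {m n} → m ℕ.≤ n → ιℕ m ≤ ιℕ n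
  ιℕ-mono-≤ {m} {n} m≤n = subst₂ _≤_ (sym (ιℕ-mkℚ m)) (sym (ιℕ-mkℚ n))
    (*≤* (subst₂ ℤ._≤_ (sym (ℤ.*-identityʳ (+ m))) (sym (ℤ.*-identityʳ (+ n))) (+≤+ m≤n)))

  ιℕ-nonNeg : ∀ n → 0ℚ ≤ ιℕ n
  ιℕ-nonNeg n = ιℕ-mono-≤ {0} {n} z≤n

  ιℕ-pos : ∀ n → 0ℚ < ιℕ (suc n)
  ιℕ-pos n = subst (0ℚ <_) (sym (ιℕ-mkℚ (suc n))) (*<* (ℤ.+<+ (s≤s z≤n)))

  nat-floor : ∀ x → 0ℚ ≤ x → ∃[ c ] (ιℕ c ≤ x × x ≤ ιℕ (suc c))
  nat-floor (mkℚ -[1+ p ] d _) (*≤* ())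
  nat-floor x@(mkℚ (+ p) d _) _ with bracket (λ c → c ℕ.* suc d) (λ c → ℕ.m<n+m (c ℕ.* suc d) (s≤s z≤n)) z≤n
  ... | c , c[1+d]≤p , p<[1+c][1+d] = c , c≤x , x≤1+c
    where
    c≤x : ιℕ c ≤ x
    c≤x = subst (_≤ x) (sym (ιℕ-mkℚ c))
      (*≤* (subst₂ ℤ._≤_ (ℤ.pos-* c (suc d)) (sym (ℤ.*-identityʳ (+ p))) (+≤+ c[1+d]≤p)))
    x≤1+c : x ≤ ιℕ (suc c)
    x≤1+c = subst (x ≤_) (sym (ιℕ-mkℚ (suc c)))
      (*≤* (subst₂ ℤ._≤_ (sym (ℤ.*-identityʳ (+ p))) (ℤ.pos-* (suc c) (suc d)) (+≤+ (ℕ.<⇒≤ p<[1+c][1+d]))))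

  ^ℚ-nonNeg : ∀ {p} k → 0ℚ ≤ p → 0ℚ ≤ p ^ℚ k
  ^ℚ-nonNeg ℕ.zero _ = *≤* (+≤+ z≤n)
  ^ℚ-nonNeg {p} (suc k) 0≤p = subst (_≤ p * p ^ℚ k) (*-zeroˡ (p ^ℚ k))
    (*-monoʳ-≤-nonNeg (p ^ℚ k) {{nonNegative (^ℚ-nonNeg k 0≤p)}} 0≤p)

  ^ℚ-monoˡ-≤ : ∀ {p q} k → 0ℚ ≤ p → p ≤ q → p ^ℚ k ≤ q ^ℚ k
  ^ℚ-monoˡ-≤ ℕ.zero _ _ = ≤-refl
  ^ℚ-monoˡ-≤ {p} {q} (suc k) 0≤p p≤q = ≤-trans
    (*-monoʳ-≤-nonNeg (p ^ℚ k) {{nonNegative (^ℚ-nonNeg k 0≤p)}} p≤q)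
    (*-monoˡ-≤-nonNeg q {{nonNegative (≤-trans 0≤p p≤q)}} (^ℚ-monoˡ-≤ k 0≤p p≤q))

  ^ℚ-distrib-* : ∀ p q k → (p * q) ^ℚ k ≡ p ^ℚ k * q ^ℚ k
  ^ℚ-distrib-* p q ℕ.zero = refl
  ^ℚ-distrib-* p q (suc k) = trans (cong (p * q *_) (^ℚ-distrib-* p q k)) (interchange p q (p ^ℚ k) (q ^ℚ k))

  approximant⇒ℚ : ∀ {a k j K c x} .{{_ : ℕ.NonZero k}} → 1ℚ ≤ x → ιℕ c ≤ x → x ≤ ιℕ (suc c) →
                  Approximant a k j K c →
                  ∃[ n ] (InS a n × x ≤ ι n × (ι n - x) ^ℚ k ≤ ιℕ (suc (K ℕ.* 2 ℕ.^ j)) ^ℚ k * x ^ℚ j)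
  approximant⇒ℚ {a} {k@(suc k′)} {j} {K} {c} {x} 1≤x c≤x x≤1+c (n , M , inS , c<n , n≤c+M , bound) =
    + n , inS , x≤n , (begin
    (ιℕ n - x) ^ℚ k             ≤⟨ ^ℚ-monoˡ-≤ k 0≤n-x n-x≤M ⟩
    ιℕ M ^ℚ k                   ≡⟨ ιℕ-^ M k ⟨
    ιℕ (M ℕ.^ k)                ≤⟨ ιℕ-mono-≤ bound ⟩
    ιℕ (K ℕ.* suc c ℕ.^ j)      ≡⟨ ιℕ-*^ K (suc c) j ⟩
    ιℕ K * ιℕ (suc c) ^ℚ j      ≤⟨ *-monoˡ-≤-nonNeg (ιℕ K) {{nonNegative (ιℕ-nonNeg K)}}
                                     (^ℚ-monoˡ-≤ j (ιℕ-nonNeg (suc c)) 1+c≤2x) ⟩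
    ιℕ K * (ιℕ 2 * x) ^ℚ j      ≡⟨ cong (ιℕ K *_) (^ℚ-distrib-* (ιℕ 2) x j) ⟩
    ιℕ K * (ιℕ 2 ^ℚ j * x ^ℚ j) ≡⟨ *-assoc (ιℕ K) (ιℕ 2 ^ℚ j) (x ^ℚ j) ⟨
    ιℕ K * ιℕ 2 ^ℚ j * x ^ℚ j   ≡⟨ cong (_* x ^ℚ j) (ιℕ-*^ K 2 j) ⟨
    ιℕ (K ℕ.* 2 ℕ.^ j) * x ^ℚ j ≤⟨ *-monoʳ-≤-nonNeg (x ^ℚ j) {{nonNegative (^ℚ-nonNeg j 0≤x)}}
                                     (ιℕ-mono-≤ K2ʲ≤Dᵏ) ⟩
    ιℕ (D ℕ.^ k) * x ^ℚ j       ≡⟨ cong (_* x ^ℚ j) (ιℕ-^ D k) ⟩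
    ιℕ D ^ℚ k * x ^ℚ j          ∎)
    where
    open ≤-Reasoning
    D = suc (K ℕ.* 2 ℕ.^ j)
    0≤x : 0ℚ ≤ x
    0≤x = ≤-trans (*≤* (+≤+ z≤n)) 1≤x
    x≤n : x ≤ ιℕ n
    x≤n = ≤-trans x≤1+c (ιℕ-mono-≤ c<n)
    0≤n-x : 0ℚ ≤ ιℕ n - x
    0≤n-x = subst (_≤ ιℕ n - x) (+-inverseʳ x) (+-monoˡ-≤ (- x) x≤n)
    n-x≤M : ιℕ n - x ≤ ιℕ M
    n-x≤M = begin
      ιℕ n - x         ≤⟨ +-monoˡ-≤ (- x) (ιℕ-mono-≤ n≤c+M) ⟩
      ιℕ (c ℕ.+ M) - x ≡⟨ cong (_- x) (ιℕ-+ c M) ⟩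
      ιℕ c + ιℕ M - x  ≤⟨ +-monoˡ-≤ (- x) (+-monoˡ-≤ (ιℕ M) c≤x) ⟩
      x + ιℕ M - x     ≡⟨ xyx⁻¹≈y x (ιℕ M) ⟩
      ιℕ M             ∎
    1+c≤2x : ιℕ (suc c) ≤ ιℕ 2 * x
    1+c≤2x = begin
      ιℕ (1 ℕ.+ c)    ≡⟨ ιℕ-+ 1 c ⟩
      1ℚ + ιℕ c       ≤⟨ +-mono-≤ 1≤x c≤x ⟩
      x + x           ≡⟨ cong₂ _+_ (*-identityˡ x) (*-identityˡ x) ⟨
      1ℚ * x + 1ℚ * x ≡⟨ *-distribʳ-+ x 1ℚ 1ℚ ⟨
      ιℕ 2 * x        ∎
    K2ʲ≤Dᵏ : K ℕ.* 2 ℕ.^ j ℕ.≤ D ℕ.^ k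
    K2ʲ≤Dᵏ = ℕ.≤-trans (ℕ.n≤1+n _) (ℕ.m≤m*n D (D ℕ.^ k′) {{ℕ.m^n≢0 D k′}})

  dense⇒ℚ : ∀ {a} k j .{{_ : ℕ.NonZero k}} → ∃[ K ] Dense a k j K →
            ∃[ D ] (0ℚ < D × ((x : ℚ) → 1ℚ ≤ x →
              ∃[ n ] (InS a n × x ≤ ι n × (ι n - x) ^ℚ k ≤ D ^ℚ k * x ^ℚ j)))
  dense⇒ℚ {a} k j (K , dense) = ιℕ (suc (K ℕ.* 2 ℕ.^ j)) , ιℕ-pos (K ℕ.* 2 ℕ.^ j) , λ x 1≤x →
    let c , c≤x , x≤1+c = nat-floor x (≤-trans (*≤* (+≤+ z≤n)) 1≤x)
    in approximant⇒ℚ {a} {k} {j} {K} 1≤x c≤x x≤1+c (dense c)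

open import Data.Integer using (ℤ; 0ℤ)
open import Data.Rational using (ℚ; _≤_; _<_; 0ℚ; 1ℚ)
open import Data.Product using (Σ; _×_; ∃-syntax)
open import Relation.Binary.PropositionalEquality using (_≢_)

open import Data.Rational using (_-_; _*_)
open import Data.Rational.Properties using (*-identityʳ)
open import Data.Product using (_,_)
open import Data.Empty using (⊥-elim)
open import Relation.Nullary using (Dec; yes; no)
open import Relation.Binary.PropositionalEquality using (subst)
open NormsOf3 using (isNorm3?)
open Approximants using (dense-1/2; dense-5/8)
open Rationals using (dense⇒ℚ)

theorem1p7 : (a : ℤ) → a ≢ 0ℤ →
    ∃[ D ] (0ℚ < D ×
      ((x : ℚ) → 1ℚ ≤ x →
        ∃[ n ] (InS a n × x ≤ ι n × UpsilonBound a D x n)))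
theorem1p7 a _ = by-cases (isNorm3? a)
  where
  by-cases : Dec (IsNorm3 a) →
             ∃[ D ] (0ℚ < D × ((x : ℚ) → 1ℚ ≤ x → ∃[ n ] (InS a n × x ≤ ι n × UpsilonBound a D x n)))
  by-cases (yes isNorm3) =
    let D , 0<D , near = dense⇒ℚ {a} 2 1 (dense-1/2 isNorm3) in
    D , 0<D , λ x 1≤x →
      let n , inS , x≤n , bound = near x 1≤x in
      n , inS , x≤n , (λ _ → subst (λ y → (ι n - x) ^ℚ 2 ≤ D ^ℚ 2 * y) (*-identityʳ x) bound) ,
      (λ ¬isNorm3 → ⊥-elim (¬isNorm3 isNorm3))
  by-cases (no ¬isNorm3) =
    let D , 0<D , near = dense⇒ℚ {a} 8 5 (dense-5/8 a) in
    D , 0<D , λ x 1≤x →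
      let n , inS , x≤n , bound = near x 1≤x in
      n , inS , x≤n , (λ isNorm3 → ⊥-elim (¬isNorm3 isNorm3)) , (λ _ → bound)
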